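{- Let $r\geq 4$ and let $M_r$ be the matrix indexed by subsets of $[r]$ with $M_r(S,T)=\binom{|S\cap T|}{2}+\binom{|\overline{S}\cap\overline{T}|}{2}$, $\overline{S}=[r]\setminus S$. Let $W\in\mathbb{R}^{\mathcal{P}([r])}$ be defined by $W_T = \binom{|T|}{2}-\binom{r-|T|}{2}$. Then $W$ is an eigenvector of $M_r$ with eigenvalue $2^{r-2}(r-1)$.
   Context: $\mathcal{P}([r])$ is the power set of $[r]=\{1,\ldots,r\}$; $\binom{n}{2}=n(n-1)/2$. -}

module Defs where

open import Data.Nat using (ℕ; zero; suc; _∸_)
open import Data.Nat.Combinatorics using (_C_)
open import Data.Integer using (ℤ; +_; _+_; _-_; _*_; 0ℤ)
open import Data.List using (List; []; _∷_; map; _++_; foldr)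
open import Data.Vec using (Vec)
import Data.Vec as V
open import Data.Fin.Subset using (Subset; inside; outside; ∁; _∩_; ∣_∣)

allSubsets : (n : ℕ) → List (Subset n)
allSubsets zero = V.[] ∷ []
allSubsets (suc n) = map (outside V.∷_) (allSubsets n) ++ map (inside V.∷_) (allSubsets n)

sumℤ : List ℤ → ℤ
sumℤ = foldr _+_ 0ℤ

M : (r : ℕ) → Subset r → Subset r → ℤ
M r S T = + (∣ S ∩ T ∣ C 2) + + (∣ ∁ S ∩ ∁ T ∣ C 2)

W : (r : ℕ) → Subset r → ℤ
W r T = + (∣ T ∣ C 2) - + ((r ∸ ∣ T ∣) C 2)

MW : (r : ℕ) → Subset r → ℤ
MW r S = sumℤ (map (λ T → M r S T * W r T) (allSubsets r))

-- Let the balance of T be e(T) = |T| − |∁ T|. Since C(t,2) − C(r−t,2) = (r−1)(2t−r)/2, W is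
-- (r−1)/2 · e, so it suffices to compute Σ_T M(S,T) e(T). Replacing T by ∁ T turns the second
-- summand of M into minus the first one taken at ∁ S, and an induction on r that splits T along
-- its first coordinate gives Σ_T C(|S ∩ T|,2) e(T) = C(|S|,2) 2^(r−1). Hence
-- Σ_T M(S,T) e(T) = 2^(r−1) W_S, and (M W)_S = 2^(r−2) (r−1) W_S.
module Submission where

open import Defs
open import Data.Nat using (ℕ; _≤_; _∸_; _^_)
open import Data.Integer using (ℤ; +_; _*_; 0ℤ)
open import Data.Fin.Subset using (Subset)
open import Data.Product using (_×_; ∃)
open import Relation.Binary.PropositionalEquality using (_≡_; _≢_)

open import Data.Nat using (zero; suc; s≤s)
import Data.Nat as N
import Data.Nat.Properties as NP
open import Data.Nat.Combinatorics using (_C_; nC1≡n; nCk+nC[k+1]≡[n+1]C[k+1])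
open import Data.Integer using (_+_; _-_; -_; 1ℤ; -1ℤ)
import Data.Integer.Properties as ZP
open import Data.Integer.Tactic.RingSolver using (solve-∀)
open import Data.List using (List; []; _∷_; map; _++_)
open import Data.List.Properties using (map-++; map-∘; map-cong)
open import Data.Vec using (_∷_; [])
open import Data.Fin.Subset using (inside; outside; ∁; _∩_; ∣_∣; ⊤)
open import Data.Fin.Subset.Properties using (∣p∣≤n; ∣∁p∣≡n∸∣p∣; ∣⊤∣≡n)
open import Data.Product using (_,_)
open import Relation.Binary.PropositionalEquality
  using (refl; sym; trans; cong; cong₂; module ≡-Reasoning)
open ≡-Reasoning

sumℤ-++ : (xs ys : List ℤ) → sumℤ (xs ++ ys) ≡ sumℤ xs + sumℤ ys
sumℤ-++ [] ys = sym (ZP.+-identityˡ _)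
sumℤ-++ (x ∷ xs) ys = trans (cong (_+_ x) (sumℤ-++ xs ys)) (sym (ZP.+-assoc x _ _))

sumℤ-map-+ : ∀ {A : Set} (f g : A → ℤ) (xs : List A) →
  sumℤ (map (λ x → f x + g x) xs) ≡ sumℤ (map f xs) + sumℤ (map g xs)
sumℤ-map-+ f g [] = refl
sumℤ-map-+ f g (x ∷ xs) =
  trans (cong (_+_ (f x + g x)) (sumℤ-map-+ f g xs)) (interchange (f x) (g x) _ _)
  where
  interchange : ∀ a b c d → (a + b) + (c + d) ≡ (a + c) + (b + d)
  interchange = solve-∀

sumℤ-map-*ˡ : ∀ {A : Set} (k : ℤ) (f : A → ℤ) (xs : List A) →
  sumℤ (map (λ x → k * f x) xs) ≡ k * sumℤ (map f xs)
sumℤ-map-*ˡ k f [] = sym (ZP.*-zeroʳ k)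
sumℤ-map-*ˡ k f (x ∷ xs) =
  trans (cong (_+_ (k * f x)) (sumℤ-map-*ˡ k f xs)) (sym (ZP.*-distribˡ-+ k (f x) _))

∑ : ∀ {n} → (Subset n → ℤ) → ℤ
∑ {n} f = sumℤ (map f (allSubsets n))

∑-cong : ∀ {n} {f g : Subset n → ℤ} → (∀ T → f T ≡ g T) → ∑ f ≡ ∑ g
∑-cong {n} f≗g = cong sumℤ (map-cong f≗g (allSubsets n))

∑-+ : ∀ {n} (f g : Subset n → ℤ) → ∑ (λ T → f T + g T) ≡ ∑ f + ∑ g
∑-+ {n} f g = sumℤ-map-+ f g (allSubsets n)

∑-*ˡ : ∀ {n} (k : ℤ) (f : Subset n → ℤ) → ∑ (λ T → k * f T) ≡ k * ∑ f
∑-*ˡ {n} k f = sumℤ-map-*ˡ k f (allSubsets n)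

∑-split : ∀ {n} (f : Subset (suc n) → ℤ) →
  ∑ f ≡ ∑ (λ T → f (outside ∷ T)) + ∑ (λ T → f (inside ∷ T))
∑-split {n} f = begin
  sumℤ (map f (map (outside ∷_) Ts ++ map (inside ∷_) Ts))
    ≡⟨ cong sumℤ (map-++ f (map (outside ∷_) Ts) _) ⟩
  sumℤ (map f (map (outside ∷_) Ts) ++ map f (map (inside ∷_) Ts))
    ≡⟨ sumℤ-++ (map f (map (outside ∷_) Ts)) (map f (map (inside ∷_) Ts)) ⟩
  sumℤ (map f (map (outside ∷_) Ts)) + sumℤ (map f (map (inside ∷_) Ts))
    ≡⟨ cong₂ _+_ (cong sumℤ (sym (map-∘ {g = f} Ts))) (cong sumℤ (sym (map-∘ {g = f} Ts))) ⟩
  ∑ (λ T → f (outside ∷ T)) + ∑ (λ T → f (inside ∷ T)) ∎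
  where Ts = allSubsets n

∑-suc : ∀ {n} (f : Subset (suc n) → ℤ) →
  ∑ f ≡ ∑ (λ T → f (outside ∷ T) + f (inside ∷ T))
∑-suc {n} f = trans (∑-split f) (sym (∑-+ {n} (λ T → f (outside ∷ T)) (λ T → f (inside ∷ T))))

∑-∘∁ : ∀ {n} (f : Subset n → ℤ) → ∑ (λ T → f (∁ T)) ≡ ∑ f
∑-∘∁ {zero} f = refl
∑-∘∁ {suc n} f = begin
  ∑ (λ T → f (∁ T))
    ≡⟨ ∑-split (λ T → f (∁ T)) ⟩
  ∑ (λ T → f (inside ∷ ∁ T)) + ∑ (λ T → f (outside ∷ ∁ T))
    ≡⟨ cong₂ _+_ (∑-∘∁ (λ T → f (inside ∷ T))) (∑-∘∁ (λ T → f (outside ∷ T))) ⟩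
  ∑ (λ T → f (inside ∷ T)) + ∑ (λ T → f (outside ∷ T))
    ≡⟨ ZP.+-comm (∑ (λ T → f (inside ∷ T))) _ ⟩
  ∑ (λ T → f (outside ∷ T)) + ∑ (λ T → f (inside ∷ T))
    ≡⟨ sym (∑-split f) ⟩
  ∑ f ∎

+2^suc : ∀ n → + (2 ^ suc n) ≡ + 2 * + (2 ^ n)
+2^suc n = ZP.pos-* 2 (2 ^ n)

*-2^suc : ∀ n s → + 2 * (s * + (2 ^ n)) ≡ s * + (2 ^ suc n)
*-2^suc n s = trans (swap s (+ (2 ^ n))) (cong (s *_) (sym (+2^suc n)))
  where
  swap : ∀ s N → + 2 * (s * N) ≡ s * (+ 2 * N)
  swap = solve-∀

∑-const : ∀ n (k : ℤ) → ∑ {n} (λ _ → k) ≡ k * + (2 ^ n)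
∑-const zero k = trans (ZP.+-identityʳ k) (sym (ZP.*-identityʳ k))
∑-const (suc n) k = begin
  ∑ {suc n} (λ _ → k)                ≡⟨ ∑-split {n} (λ _ → k) ⟩
  ∑ {n} (λ _ → k) + ∑ {n} (λ _ → k)  ≡⟨ cong₂ _+_ (∑-const n k) (∑-const n k) ⟩
  k * + (2 ^ n) + k * + (2 ^ n)      ≡⟨ double k (+ (2 ^ n)) ⟩
  k * (+ 2 * + (2 ^ n))              ≡⟨ cong (k *_) (sym (+2^suc n)) ⟩
  k * + (2 ^ suc n)                  ∎
  where
  double : ∀ k N → k * N + k * N ≡ k * (+ 2 * N)
  double = solve-∀

+[sucm]C2 : ∀ m → + (suc m C 2) ≡ + (m C 2) + + m
+[sucm]C2 m = begin
  + (suc m C 2)         ≡⟨ cong +_ (sym (nCk+nC[k+1]≡[n+1]C[k+1] m 1)) ⟩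
  + (m C 1 N.+ m C 2)   ≡⟨ cong (λ k → + (k N.+ m C 2)) (nC1≡n m) ⟩
  + (m N.+ m C 2)       ≡⟨ cong +_ (NP.+-comm m (m C 2)) ⟩
  + (m C 2 N.+ m)       ≡⟨ ZP.pos-+ (m C 2) m ⟩
  + (m C 2) + + m       ∎

+2*C2≡m*[m-1] : ∀ m → + 2 * + (m C 2) ≡ + m * (+ m - 1ℤ)
+2*C2≡m*[m-1] zero = refl
+2*C2≡m*[m-1] (suc m) = begin
  + 2 * + (suc m C 2)        ≡⟨ cong (+ 2 *_) (+[sucm]C2 m) ⟩
  + 2 * (+ (m C 2) + + m)    ≡⟨ ZP.*-distribˡ-+ (+ 2) (+ (m C 2)) (+ m) ⟩
  + 2 * + (m C 2) + + 2 * + m ≡⟨ cong (_+ + 2 * + m) (+2*C2≡m*[m-1] m) ⟩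
  + m * (+ m - 1ℤ) + + 2 * + m ≡⟨ factor (+ m) ⟩
  (1ℤ + + m) * ((1ℤ + + m) - 1ℤ) ∎
  where
  factor : ∀ m → m * (m - 1ℤ) + + 2 * m ≡ (1ℤ + m) * ((1ℤ + m) - 1ℤ)
  factor = solve-∀

balance : ∀ {n} → Subset n → ℤ
balance [] = 0ℤ
balance (outside ∷ T) = -1ℤ + balance T
balance (inside ∷ T) = 1ℤ + balance T

balance≡∣T∣-∣∁T∣ : ∀ {n} (T : Subset n) → balance T ≡ + ∣ T ∣ - + ∣ ∁ T ∣
balance≡∣T∣-∣∁T∣ [] = refl
balance≡∣T∣-∣∁T∣ (outside ∷ T) = trans (cong (_+_ -1ℤ) (balance≡∣T∣-∣∁T∣ T)) (shift (+ ∣ T ∣) (+ ∣ ∁ T ∣))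
  where
  shift : ∀ t k → -1ℤ + (t - k) ≡ t - (1ℤ + k)
  shift = solve-∀
balance≡∣T∣-∣∁T∣ (inside ∷ T) = trans (cong (_+_ 1ℤ) (balance≡∣T∣-∣∁T∣ T)) (shift (+ ∣ T ∣) (+ ∣ ∁ T ∣))
  where
  shift : ∀ t k → 1ℤ + (t - k) ≡ (1ℤ + t) - k
  shift = solve-∀

balance-∁ : ∀ {n} (T : Subset n) → balance (∁ T) ≡ - balance T
balance-∁ [] = refl
balance-∁ (outside ∷ T) = trans (cong (_+_ 1ℤ) (balance-∁ T)) (flip (balance T))
  where
  flip : ∀ x → 1ℤ + - x ≡ - (-1ℤ + x)
  flip = solve-∀
balance-∁ (inside ∷ T) = trans (cong (_+_ -1ℤ) (balance-∁ T)) (flip (balance T))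
  where
  flip : ∀ x → -1ℤ + - x ≡ - (1ℤ + x)
  flip = solve-∀

∑-balance : ∀ n → ∑ (balance {n}) ≡ 0ℤ
∑-balance zero = refl
∑-balance (suc n) = begin
  ∑ (balance {suc n})
    ≡⟨ ∑-suc {n} balance ⟩
  ∑ (λ T → (-1ℤ + balance {n} T) + (1ℤ + balance T))
    ≡⟨ ∑-cong {n} (λ T → cancel (balance T)) ⟩
  ∑ (λ T → + 2 * balance {n} T)
    ≡⟨ ∑-*ˡ {n} (+ 2) balance ⟩
  + 2 * ∑ (balance {n})
    ≡⟨ cong (+ 2 *_) (∑-balance n) ⟩
  0ℤ ∎
  where
  cancel : ∀ b → (-1ℤ + b) + (1ℤ + b) ≡ + 2 * b
  cancel = solve-∀

W-balance : ∀ n (T : Subset n) → + 2 * W n T ≡ (+ n - 1ℤ) * balance T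
W-balance n T = begin
  + 2 * (+ (∣ T ∣ C 2) - + (k C 2))           ≡⟨ distrib (+ (∣ T ∣ C 2)) (+ (k C 2)) ⟩
  + 2 * + (∣ T ∣ C 2) - + 2 * + (k C 2)      ≡⟨ cong₂ _-_ (+2*C2≡m*[m-1] ∣ T ∣) (+2*C2≡m*[m-1] k) ⟩
  + ∣ T ∣ * (+ ∣ T ∣ - 1ℤ) - + k * (+ k - 1ℤ) ≡⟨ factor (+ ∣ T ∣) (+ k) ⟩
  (+ ∣ T ∣ + + k - 1ℤ) * (+ ∣ T ∣ - + k)      ≡⟨ cong₂ _*_ (cong (_- 1ℤ) ∣T∣+k≡n) (sym balance≡∣T∣-k) ⟩
  (+ n - 1ℤ) * balance T                       ∎
  where
  k = n ∸ ∣ T ∣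
  ∣T∣+k≡n : + ∣ T ∣ + + k ≡ + n
  ∣T∣+k≡n = trans (sym (ZP.pos-+ ∣ T ∣ k)) (cong +_ (NP.m+[n∸m]≡n (∣p∣≤n T)))
  balance≡∣T∣-k : balance T ≡ + ∣ T ∣ - + k
  balance≡∣T∣-k = trans (balance≡∣T∣-∣∁T∣ T) (cong (λ m → + ∣ T ∣ - + m) (∣∁p∣≡n∸∣p∣ T))
  distrib : ∀ x y → + 2 * (x - y) ≡ + 2 * x - + 2 * y
  distrib = solve-∀
  factor : ∀ t k → t * (t - 1ℤ) - k * (k - 1ℤ) ≡ (t + k - 1ℤ) * (t - k)
  factor = solve-∀

∑-∘∁-*balance : ∀ {n} (g : Subset n → ℤ) →
  ∑ (λ T → g (∁ T) * balance T) ≡ - ∑ (λ T → g T * balance T)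
∑-∘∁-*balance g = begin
  ∑ (λ T → g (∁ T) * balance T)
    ≡⟨ ∑-cong (λ T → cong (g (∁ T) *_) (sym (balance-∁∘∁ T))) ⟩
  ∑ (λ T → g (∁ T) * - balance (∁ T))
    ≡⟨ ∑-∘∁ (λ T → g T * - balance T) ⟩
  ∑ (λ T → g T * - balance T)
    ≡⟨ ∑-cong (λ T → pull (g T) (balance T)) ⟩
  ∑ (λ T → -1ℤ * (g T * balance T))
    ≡⟨ ∑-*ˡ -1ℤ (λ T → g T * balance T) ⟩
  -1ℤ * ∑ (λ T → g T * balance T)
    ≡⟨ ZP.-1*i≡-i _ ⟩
  - ∑ (λ T → g T * balance T) ∎
  where
  balance-∁∘∁ : ∀ T → - balance (∁ T) ≡ balance T
  balance-∁∘∁ T = trans (cong -_ (balance-∁ T)) (ZP.neg-involutive (balance T))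
  pull : ∀ x b → x * - b ≡ -1ℤ * (x * b)
  pull = solve-∀

-- Σ_T |S ∩ T| and Σ_T |S ∩ T| e(T) both equal |S| 2^(n−1); only their sum is needed.
∑-∣∩∣*[1+balance] : ∀ {n} (S : Subset n) →
  ∑ (λ T → + ∣ S ∩ T ∣ * (1ℤ + balance T)) ≡ + ∣ S ∣ * + (2 ^ n)
∑-∣∩∣*[1+balance] [] = refl
∑-∣∩∣*[1+balance] {suc n} (outside ∷ S) = begin
  ∑ (λ T → + ∣ (outside ∷ S) ∩ T ∣ * (1ℤ + balance T))
    ≡⟨ ∑-suc (λ T → + ∣ (outside ∷ S) ∩ T ∣ * (1ℤ + balance T)) ⟩
  ∑ (λ T → a T * (1ℤ + (-1ℤ + balance T)) + a T * (1ℤ + (1ℤ + balance T)))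
    ≡⟨ ∑-cong (λ T → combine (a T) (balance T)) ⟩
  ∑ (λ T → + 2 * (a T * (1ℤ + balance T)))
    ≡⟨ ∑-*ˡ (+ 2) (λ T → a T * (1ℤ + balance T)) ⟩
  + 2 * ∑ (λ T → a T * (1ℤ + balance T))
    ≡⟨ cong (+ 2 *_) (∑-∣∩∣*[1+balance] S) ⟩
  + 2 * (+ ∣ S ∣ * + (2 ^ n))
    ≡⟨ *-2^suc n (+ ∣ S ∣) ⟩
  + ∣ S ∣ * + (2 ^ suc n) ∎
  where
  a : Subset n → ℤ
  a T = + ∣ S ∩ T ∣
  combine : ∀ x b → x * (1ℤ + (-1ℤ + b)) + x * (1ℤ + (1ℤ + b)) ≡ + 2 * (x * (1ℤ + b))
  combine = solve-∀
∑-∣∩∣*[1+balance] {suc n} (inside ∷ S) = begin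
  ∑ (λ T → + ∣ (inside ∷ S) ∩ T ∣ * (1ℤ + balance T))
    ≡⟨ ∑-suc (λ T → + ∣ (inside ∷ S) ∩ T ∣ * (1ℤ + balance T)) ⟩
  ∑ (λ T → a T * (1ℤ + (-1ℤ + balance T)) + (1ℤ + a T) * (1ℤ + (1ℤ + balance T)))
    ≡⟨ ∑-cong (λ T → combine (a T) (balance T)) ⟩
  ∑ (λ T → + 2 * (a T * (1ℤ + balance T)) + (+ 2 + balance T))
    ≡⟨ ∑-+ (λ T → + 2 * (a T * (1ℤ + balance T))) (λ T → + 2 + balance {n} T) ⟩
  ∑ (λ T → + 2 * (a T * (1ℤ + balance T))) + ∑ (λ T → + 2 + balance {n} T)
    ≡⟨ cong₂ _+_ (∑-*ˡ (+ 2) (λ T → a T * (1ℤ + balance T))) (∑-+ {n} (λ _ → + 2) balance) ⟩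
  + 2 * ∑ (λ T → a T * (1ℤ + balance T)) + (∑ {n} (λ _ → + 2) + ∑ (balance {n}))
    ≡⟨ cong₂ (λ u v → + 2 * u + v) (∑-∣∩∣*[1+balance] S) (cong₂ _+_ (∑-const n (+ 2)) (∑-balance n)) ⟩
  + 2 * (+ ∣ S ∣ * N) + (+ 2 * N + 0ℤ)
    ≡⟨ collect (+ ∣ S ∣) N ⟩
  + 2 * ((1ℤ + + ∣ S ∣) * N)
    ≡⟨ *-2^suc n (1ℤ + + ∣ S ∣) ⟩
  (1ℤ + + ∣ S ∣) * + (2 ^ suc n) ∎
  where
  a : Subset n → ℤ
  a T = + ∣ S ∩ T ∣
  N = + (2 ^ n)
  combine : ∀ x b → x * (1ℤ + (-1ℤ + b)) + (1ℤ + x) * (1ℤ + (1ℤ + b))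
                    ≡ + 2 * (x * (1ℤ + b)) + (+ 2 + b)
  combine = solve-∀
  collect : ∀ s N → + 2 * (s * N) + (+ 2 * N + 0ℤ) ≡ + 2 * ((1ℤ + s) * N)
  collect = solve-∀

∑-C2∣∩∣*balance : ∀ {n} (S : Subset n) →
  + 2 * ∑ (λ T → + (∣ S ∩ T ∣ C 2) * balance T) ≡ + (∣ S ∣ C 2) * + (2 ^ n)
∑-C2∣∩∣*balance [] = refl
∑-C2∣∩∣*balance {suc n} (outside ∷ S) = begin
  + 2 * ∑ (λ T → + (∣ (outside ∷ S) ∩ T ∣ C 2) * balance T)
    ≡⟨ cong (+ 2 *_) (∑-suc (λ T → + (∣ (outside ∷ S) ∩ T ∣ C 2) * balance T)) ⟩
  + 2 * ∑ (λ T → c T * (-1ℤ + balance T) + c T * (1ℤ + balance T))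
    ≡⟨ cong (+ 2 *_) (∑-cong (λ T → combine (c T) (balance T))) ⟩
  + 2 * ∑ (λ T → + 2 * (c T * balance T))
    ≡⟨ cong (+ 2 *_) (∑-*ˡ (+ 2) (λ T → c T * balance T)) ⟩
  + 2 * (+ 2 * ∑ (λ T → c T * balance T))
    ≡⟨ cong (+ 2 *_) (∑-C2∣∩∣*balance S) ⟩
  + 2 * (+ (∣ S ∣ C 2) * + (2 ^ n))
    ≡⟨ *-2^suc n (+ (∣ S ∣ C 2)) ⟩
  + (∣ S ∣ C 2) * + (2 ^ suc n) ∎
  where
  c : Subset n → ℤ
  c T = + (∣ S ∩ T ∣ C 2)
  combine : ∀ x b → x * (-1ℤ + b) + x * (1ℤ + b) ≡ + 2 * (x * b)
  combine = solve-∀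
∑-C2∣∩∣*balance {suc n} (inside ∷ S) = begin
  + 2 * ∑ (λ T → + (∣ (inside ∷ S) ∩ T ∣ C 2) * balance T)
    ≡⟨ cong (+ 2 *_) (∑-suc (λ T → + (∣ (inside ∷ S) ∩ T ∣ C 2) * balance T)) ⟩
  + 2 * ∑ (λ T → c T * (-1ℤ + balance T) + + (suc ∣ S ∩ T ∣ C 2) * (1ℤ + balance T))
    ≡⟨ cong (+ 2 *_) (∑-cong (λ T → pointwise T)) ⟩
  + 2 * ∑ (λ T → + 2 * (c T * balance T) + a T * (1ℤ + balance T))
    ≡⟨ cong (+ 2 *_) (∑-+ (λ T → + 2 * (c T * balance T)) (λ T → a T * (1ℤ + balance T))) ⟩
  + 2 * (∑ (λ T → + 2 * (c T * balance T)) + ∑ (λ T → a T * (1ℤ + balance T)))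
    ≡⟨ cong (λ u → + 2 * (u + ∑ (λ T → a T * (1ℤ + balance T)))) (∑-*ˡ (+ 2) (λ T → c T * balance T)) ⟩
  + 2 * (+ 2 * ∑ (λ T → c T * balance T) + ∑ (λ T → a T * (1ℤ + balance T)))
    ≡⟨ ZP.*-distribˡ-+ (+ 2) (+ 2 * ∑ (λ T → c T * balance T)) (∑ (λ T → a T * (1ℤ + balance T))) ⟩
  + 2 * (+ 2 * ∑ (λ T → c T * balance T)) + + 2 * ∑ (λ T → a T * (1ℤ + balance T))
    ≡⟨ cong₂ (λ u v → + 2 * u + + 2 * v) (∑-C2∣∩∣*balance S) (∑-∣∩∣*[1+balance] S) ⟩
  + 2 * (cs * N) + + 2 * (+ ∣ S ∣ * N)
    ≡⟨ collect cs (+ ∣ S ∣) N ⟩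
  + 2 * ((cs + + ∣ S ∣) * N)
    ≡⟨ *-2^suc n (cs + + ∣ S ∣) ⟩
  (cs + + ∣ S ∣) * + (2 ^ suc n)
    ≡⟨ cong (_* + (2 ^ suc n)) (sym (+[sucm]C2 ∣ S ∣)) ⟩
  + (suc ∣ S ∣ C 2) * + (2 ^ suc n) ∎
  where
  c a : Subset n → ℤ
  c T = + (∣ S ∩ T ∣ C 2)
  a T = + ∣ S ∩ T ∣
  cs = + (∣ S ∣ C 2)
  N = + (2 ^ n)
  collect : ∀ c s N → + 2 * (c * N) + + 2 * (s * N) ≡ + 2 * ((c + s) * N)
  collect = solve-∀
  combine : ∀ x y b → x * (-1ℤ + b) + (x + y) * (1ℤ + b) ≡ + 2 * (x * b) + y * (1ℤ + b)
  combine = solve-∀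
  pointwise : ∀ T → c T * (-1ℤ + balance T) + + (suc ∣ S ∩ T ∣ C 2) * (1ℤ + balance T)
                    ≡ + 2 * (c T * balance T) + a T * (1ℤ + balance T)
  pointwise T = trans (cong (λ u → c T * (-1ℤ + balance T) + u * (1ℤ + balance T)) (+[sucm]C2 ∣ S ∩ T ∣))
                      (combine (c T) (a T) (balance T))

∑-M*balance : ∀ n (S : Subset n) → + 2 * ∑ (λ T → M n S T * balance T) ≡ + (2 ^ n) * W n S
∑-M*balance n S = begin
  + 2 * ∑ (λ T → M n S T * balance T)
    ≡⟨ cong (+ 2 *_) (∑-cong (λ T → ZP.*-distribʳ-+ (balance T) (c S T) (c (∁ S) (∁ T)))) ⟩
  + 2 * ∑ (λ T → c S T * balance T + c (∁ S) (∁ T) * balance T)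
    ≡⟨ cong (+ 2 *_) (∑-+ (λ T → c S T * balance T) (λ T → c (∁ S) (∁ T) * balance T)) ⟩
  + 2 * (Y S + ∑ (λ T → c (∁ S) (∁ T) * balance T))
    ≡⟨ cong (λ u → + 2 * (Y S + u)) (∑-∘∁-*balance (c (∁ S))) ⟩
  + 2 * (Y S - Y (∁ S))
    ≡⟨ distrib (Y S) (Y (∁ S)) ⟩
  + 2 * Y S - + 2 * Y (∁ S)
    ≡⟨ cong₂ _-_ (∑-C2∣∩∣*balance S) (∑-C2∣∩∣*balance (∁ S)) ⟩
  + (∣ S ∣ C 2) * N - + (∣ ∁ S ∣ C 2) * N
    ≡⟨ cong (λ m → + (∣ S ∣ C 2) * N - + (m C 2) * N) (∣∁p∣≡n∸∣p∣ S) ⟩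
  + (∣ S ∣ C 2) * N - + ((n ∸ ∣ S ∣) C 2) * N
    ≡⟨ factor N (+ (∣ S ∣ C 2)) (+ ((n ∸ ∣ S ∣) C 2)) ⟩
  N * W n S ∎
  where
  N = + (2 ^ n)
  c : Subset n → Subset n → ℤ
  c S T = + (∣ S ∩ T ∣ C 2)
  Y : Subset n → ℤ
  Y S = ∑ (λ T → c S T * balance T)
  distrib : ∀ x y → + 2 * (x - y) ≡ + 2 * x - + 2 * y
  distrib = solve-∀
  factor : ∀ N x y → x * N - y * N ≡ N * (x - y)
  factor = solve-∀

+4*MW : ∀ n (S : Subset n) → + 4 * MW n S ≡ (+ n - 1ℤ) * (+ (2 ^ n) * W n S)
+4*MW n S = begin
  + 4 * ∑ (λ T → M n S T * W n T)
    ≡⟨ ZP.*-assoc (+ 2) (+ 2) _ ⟩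
  + 2 * (+ 2 * ∑ (λ T → M n S T * W n T))
    ≡⟨ cong (+ 2 *_) (sym (∑-*ˡ (+ 2) (λ T → M n S T * W n T))) ⟩
  + 2 * ∑ (λ T → + 2 * (M n S T * W n T))
    ≡⟨ cong (+ 2 *_) (∑-cong pointwise) ⟩
  + 2 * ∑ (λ T → (+ n - 1ℤ) * (M n S T * balance T))
    ≡⟨ cong (+ 2 *_) (∑-*ˡ (+ n - 1ℤ) (λ T → M n S T * balance T)) ⟩
  + 2 * ((+ n - 1ℤ) * ∑ (λ T → M n S T * balance T))
    ≡⟨ swap (+ 2) (+ n - 1ℤ) _ ⟩
  (+ n - 1ℤ) * (+ 2 * ∑ (λ T → M n S T * balance T))
    ≡⟨ cong ((+ n - 1ℤ) *_) (∑-M*balance n S) ⟩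
  (+ n - 1ℤ) * (+ (2 ^ n) * W n S) ∎
  where
  swap : ∀ a b c → a * (b * c) ≡ b * (a * c)
  swap = solve-∀
  pointwise : ∀ T → + 2 * (M n S T * W n T) ≡ (+ n - 1ℤ) * (M n S T * balance T)
  pointwise T = begin
    + 2 * (M n S T * W n T)            ≡⟨ swap (+ 2) (M n S T) (W n T) ⟩
    M n S T * (+ 2 * W n T)            ≡⟨ cong (M n S T *_) (W-balance n T) ⟩
    M n S T * ((+ n - 1ℤ) * balance T) ≡⟨ swap (M n S T) (+ n - 1ℤ) (balance T) ⟩
    (+ n - 1ℤ) * (M n S T * balance T) ∎

MW-eigen : ∀ q (S : Subset (suc (suc q))) →
  MW (suc (suc q)) S ≡ + ((2 ^ q) N.* suc q) * W (suc (suc q)) S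
MW-eigen q S = ZP.*-cancelˡ-≡ (+ 4) _ _ (begin
  + 4 * MW r S
    ≡⟨ +4*MW r S ⟩
  (+ r - 1ℤ) * (+ (2 ^ r) * W r S)
    ≡⟨ cong (λ N → (+ r - 1ℤ) * (N * W r S)) (trans (+2^suc (suc q)) (cong (+ 2 *_) (+2^suc q))) ⟩
  (+ r - 1ℤ) * (+ 2 * (+ 2 * + (2 ^ q)) * W r S)
    ≡⟨ regroup (+ suc q) (+ (2 ^ q)) (W r S) ⟩
  + 4 * (+ (2 ^ q) * + suc q * W r S)
    ≡⟨ cong (λ x → + 4 * (x * W r S)) (sym (ZP.pos-* (2 ^ q) (suc q))) ⟩
  + 4 * (+ ((2 ^ q) N.* suc q) * W r S) ∎)
  where
  r = suc (suc q)
  regroup : ∀ s P w → ((1ℤ + s) - 1ℤ) * (+ 2 * (+ 2 * P) * w) ≡ + 4 * (P * s * w)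
  regroup = solve-∀

W-⊤ : ∀ n → W n ⊤ ≡ + (n C 2)
W-⊤ n = begin
  + (∣ ⊤ {n} ∣ C 2) - + ((n ∸ ∣ ⊤ {n} ∣) C 2) ≡⟨ cong (λ t → + (t C 2) - + ((n ∸ t) C 2)) (∣⊤∣≡n n) ⟩
  + (n C 2) - + ((n ∸ n) C 2)                 ≡⟨ cong (λ m → + (n C 2) - + (m C 2)) (NP.n∸n≡0 n) ⟩
  + (n C 2) - 0ℤ                              ≡⟨ ZP.+-identityʳ _ ⟩
  + (n C 2)                                   ∎

+[2+q]C2≢0 : ∀ q → + (suc (suc q) C 2) ≢ 0ℤ
+[2+q]C2≢0 q eq with trans (sym (trans (+[sucm]C2 (suc q)) (cong +_ (NP.+-suc (suc q C 2) q)))) eq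
... | ()

mainTheorem8 : (r : ℕ) → 4 ≤ r →
    ((S : Subset r) → MW r S ≡ + ((2 ^ (r ∸ 2)) Data.Nat.* (r ∸ 1)) * W r S)
    × ∃ (λ (T : Subset r) → W r T ≢ 0ℤ)
mainTheorem8 (suc (suc q)) (s≤s (s≤s _)) =
  MW-eigen q , (⊤ , λ W⊤≡0 → +[2+q]C2≢0 q (trans (sym (W-⊤ (suc (suc q)))) W⊤≡0))
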